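{- The axiom system $\mathsf{EKB}$ is complete for $\mathcal{L}_{E,K,B}$ with respect to the class of evidence models satisfying (E1) under doxastic-evidence semantics: every formula true at every doxastic evidence scenario of every evidence model satisfying (E1) is a theorem of $\mathsf{EKB}$.
   Context: $\mathcal{L}_{E,K,B}$ is generated by $\phi ::= p \mid \neg\phi \mid \phi\wedge\psi \mid E\phi \mid K\phi \mid B\phi$, $p$ in a countable set $\textsc{prop}$. An evidence model is $(X,\mathcal{E},I,v)$ with $X$ nonempty, $\mathcal{E}$ nonempty, $I_e:X\to 2^X$ for $e\in\mathcal{E}$, $v:\textsc{prop}\to 2^X$; $U_e=\{x : x\in I_e(x)\}$. (E1): $y\in I_e(x)$ implies $y\in I_e(y)$. A doxastic evidence scenario is $(x,e,V)$ with $x\in U_e$ and $\emptyset\neq V\subseteq U_e$. Doxastic-evidence semantics: $p$ via $v$; Booleans as usual; $(x,e,V)\models E\phi$ iff $I_e(x)\subseteq[\![\phi]\!]^{e,V}$; $(x,e,V)\models K\phi$ iff $U_e\subseteq[\![\phi]\!]^{e,V}$; $(x,e,V)\models B\phi$ iff $V\subseteq[\![\phi]\!]^{e,V}$, where $[\![\phi]\!]^{e,V}=\{y\in U_e : (y,e,V)\models\phi\}$. $\mathsf{EKB}$: classical propositional logic with modus ponens; $\mathsf{S5}$ for $K$ (K, T, 4, 5 axioms, necessitation); $\mathsf{KT}$ for $E$ (K, T axioms, necessitation); $K\phi\to E\phi$; $B(\phi\to\psi)\to(B\phi\to B\psi)$; $B\phi\to\neg B\neg\phi$; $B\phi\to KB\phi$;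 $K\phi\to B\phi$. -}

module Defs where

open import Data.Nat using (ℕ)
open import Data.Bool using (Bool; true; false; not; _∧_)
open import Data.Product using (Σ; ∃; _×_; _,_)
open import Data.Empty using (⊥)
open import Relation.Nullary using (¬_)
open import Relation.Binary.PropositionalEquality using (_≡_)

Prop : Set
Prop = ℕ

data Form : Set where
  var : Prop → Form
  ~_  : Form → Form
  _∧'_ : Form → Form → Form
  E   : Form → Form
  K   : Form → Form
  B   : Form → Form

infix 30 ~_
infixr 20 _∧'_
infixr 10 _⇒_

_⇒_ : Form → Form → Form
φ ⇒ ψ = ~ (φ ∧' ~ ψ)

-- Evidence models (X, 𝓔, I, v); subsets are predicates.

record EvidenceModel : Set₁ where
  field
    X     : Set
    Ev    : Set
    x₀    : X                      -- X nonempty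
    e₀    : Ev                     -- 𝓔 nonempty
    I     : Ev → X → X → Set       -- I e x y  means  y ∈ I_e(x)
    v     : Prop → X → Set         -- v p x    means  x ∈ v(p)

  U : Ev → X → Set
  U e x = I e x x

E1 : EvidenceModel → Set
E1 M = ∀ e x y → I e x y → I e y y
  where open EvidenceModel M

-- Doxastic-evidence semantics: (x, e, V) ⊨ φ.
-- [[φ]]^{e,V} = { y ∈ U_e : (y,e,V) ⊨ φ }.
module _ (M : EvidenceModel) where
  open EvidenceModel M

  sat : Ev → (X → Set) → X → Form → Set
  sat e V x (var p)  = v p x
  sat e V x (~ φ)    = ¬ sat e V x φ
  sat e V x (φ ∧' ψ) = sat e V x φ × sat e V x ψ
  sat e V x (E φ)    = ∀ y → I e x y → U e y × sat e V y φ
  sat e V x (K φ)    = ∀ y → U e y → sat e V y φ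
  sat e V x (B φ)    = ∀ y → V y → U e y × sat e V y φ

record Scenario (M : EvidenceModel) : Set₁ where
  open EvidenceModel M
  field
    e      : Ev
    x      : X
    x∈U    : U e x
    V      : X → Set
    V⊆U    : ∀ y → V y → U e y
    V≠∅    : ∃ λ y → V y

Valid-E1 : Form → Set₁
Valid-E1 φ = (M : EvidenceModel) → E1 M → (s : Scenario M) →
  sat M (Scenario.e s) (Scenario.V s) (Scenario.x s) φ

-- Classical propositional logic: all substitution instances of
-- propositional tautologies (modal formulas are treated as atoms).
evalPL : (Form → Bool) → Form → Bool
evalPL f (var p)  = f (var p)
evalPL f (~ φ)    = not (evalPL f φ)
evalPL f (φ ∧' ψ) = evalPL f φ ∧ evalPL f ψ
evalPL f (E φ)    = f (E φ)
evalPL f (K φ)    = f (K φ)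
evalPL f (B φ)    = f (B φ)

Tautology : Form → Set
Tautology φ = (f : Form → Bool) → evalPL f φ ≡ true

data ⊢_ : Form → Set where
  taut  : ∀ {φ} → Tautology φ → ⊢ φ
  mp    : ∀ {φ ψ} → ⊢ (φ ⇒ ψ) → ⊢ φ → ⊢ ψ
  K-K   : ∀ {φ ψ} → ⊢ (K (φ ⇒ ψ) ⇒ (K φ ⇒ K ψ))
  K-T   : ∀ {φ} → ⊢ (K φ ⇒ φ)
  K-4   : ∀ {φ} → ⊢ (K φ ⇒ K (K φ))
  K-5   : ∀ {φ} → ⊢ (~ K φ ⇒ K (~ K φ))
  K-nec : ∀ {φ} → ⊢ φ → ⊢ K φ
  E-K   : ∀ {φ ψ} → ⊢ (E (φ ⇒ ψ) ⇒ (E φ ⇒ E ψ))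
  E-T   : ∀ {φ} → ⊢ (E φ ⇒ φ)
  E-nec : ∀ {φ} → ⊢ φ → ⊢ E φ
  KE    : ∀ {φ} → ⊢ (K φ ⇒ E φ)
  B-K   : ∀ {φ ψ} → ⊢ (B (φ ⇒ ψ) ⇒ (B φ ⇒ B ψ))
  B-D   : ∀ {φ} → ⊢ (B φ ⇒ ~ B (~ φ))
  BKB   : ∀ {φ} → ⊢ (B φ ⇒ K (B φ))
  KB    : ∀ {φ} → ⊢ (K φ ⇒ B φ)

infix 5 ⊢_

-- Fix φ.  A type is a truth assignment to the atoms of φ (its letters and
-- modal subformulas).  A list S of types is a cover if every formula true
-- under all valuations whose type lies in S is a theorem; the list of all
-- types is a cover.  A type t is defective in S if it accepts □ψ but
-- falsifies ψ for factive □ (K, E), rejects □ψ while S holds no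
-- counterexample in t's K/B-profile, or has no belief-successor in S.  For
-- each defect the axioms refute the characteristic formula of t, via the
-- general facts `transfer' (normal operators below K) and
-- `belief-consistent' (axiom D), so t can be removed keeping a cover.  When
-- no defects remain, either every type of S satisfies φ, making φ a theorem,
-- or some type t₀ falsifies φ; the types of S in t₀'s profile then form an
-- evidence model with (E1) whose truth lemma refutes φ at a scenario.

module Submission where

open import Defs
open import Data.Bool using (Bool; true; false; not; _∧_; if_then_else_)
open import Data.Bool.Properties using (∧-conicalˡ; ∧-conicalʳ; not-¬; ¬-not; not-injective)
  renaming (_≟_ to _≟ᵇ_)
open import Data.Nat using (ℕ; zero; suc; _<_)
open import Data.Nat.Properties using () renaming (_≟_ to _≟ℕ_)
open import Data.Nat.Induction using (<-wellFounded)
open import Data.List using (List; []; _∷_; _++_; map; length; filter; concatMap)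
open import Data.List.Properties using (length-map; filter-notAll)
  renaming (≡-dec to ≡-decᴸ)
open import Data.List.Relation.Unary.All as All using (All; []; _∷_; all?)
open import Data.List.Relation.Unary.All.Properties using (map⁺; map⁻)
open import Data.List.Relation.Unary.Any as Any using (Any; here; there; any?)
open import Data.List.Relation.Binary.Subset.Propositional using (_⊆_)
open import Data.List.Membership.Propositional using (_∈_; find; lose)
open import Data.List.Membership.Propositional.Properties
  using (∈-++⁺ˡ; ∈-++⁺ʳ; ∈-++⁻; ∈-map⁺; ∈-filter⁺; ∈-filter⁻; ∈-concatMap⁺; ∈-concatMap⁻)
open import Data.Product using (∃; _×_; _,_; proj₁; proj₂)
open import Data.Sum as Sum using (_⊎_; inj₁; inj₂)
open import Data.Empty using (⊥-elim)
open import Data.Unit using (⊤; tt)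
open import Function using (_∘_; id)
open import Function.Bundles using (_⇔_; mk⇔; Equivalence)
open import Induction.WellFounded using (Acc; acc)
open import Relation.Nullary using (¬_; Dec; yes; no; ¬?)
open import Relation.Nullary.Decidable using (map′; toSum; _×-dec_; _→-dec_; does; decidable-stable)
open import Relation.Binary.Definitions using (DecidableEquality)
open import Relation.Binary.PropositionalEquality using (_≡_; refl; sym; trans; cong; cong₂; subst)

open Equivalence using (to; from)

variable
  f g : Form → Bool
  φ ψ θ a : Form
  Γ L : List Form

-- f ⊨ φ: φ evaluates to true when its atoms (letters and modal formulas)
-- are interpreted by f.  A record, so that φ can be inferred from a proof.
record _⊨_ (f : Form → Bool) (φ : Form) : Set where
  constructor ⊨-intro
  field ⊨-elim : evalPL f φ ≡ true
open _⊨_ public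

infix 4 _⊨_

⊨? : ∀ f φ → Dec (f ⊨ φ)
⊨? f φ = map′ ⊨-intro ⊨-elim (evalPL f φ ≟ᵇ true)

⊨-∧ : f ⊨ (φ ∧' ψ) → f ⊨ φ × f ⊨ ψ
⊨-∧ (⊨-intro h) = ⊨-intro (∧-conicalˡ _ _ h) , ⊨-intro (∧-conicalʳ _ _ h)

⊨-∧⁺ : f ⊨ φ → f ⊨ ψ → f ⊨ (φ ∧' ψ)
⊨-∧⁺ (⊨-intro p) (⊨-intro q) = ⊨-intro (cong₂ _∧_ p q)

⊨-~ : f ⊨ ~ φ → ¬ f ⊨ φ
⊨-~ (⊨-intro h) (⊨-intro p) = not-¬ p (not-injective {y = false} h)

⊨-~⁺ : ¬ f ⊨ φ → f ⊨ ~ φ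
⊨-~⁺ h = ⊨-intro (cong not (¬-not (h ∘ ⊨-intro)))

⊨-⇒ : f ⊨ (φ ⇒ ψ) → f ⊨ φ → f ⊨ ψ
⊨-⇒ {f} {ψ = ψ} h p with ⊨? f ψ
... | yes q = q
... | no ¬q = ⊥-elim (⊨-~ h (⊨-∧⁺ p (⊨-~⁺ ¬q)))

⊨-⇒⁺ : (f ⊨ φ → f ⊨ ψ) → f ⊨ (φ ⇒ ψ)
⊨-⇒⁺ g = ⊨-~⁺ λ c → ⊨-~ (proj₂ (⊨-∧ c)) (g (proj₁ (⊨-∧ c)))

consequence : All ⊢_ Γ → (∀ f → All (f ⊨_) Γ → f ⊨ ψ) → ⊢ ψ
consequence [] h = taut λ f → ⊨-elim (h f [])
consequence (⊢γ ∷ ⊢Γ) h = mp (consequence ⊢Γ λ f hs → ⊨-⇒⁺ λ hγ → h f (hγ ∷ hs)) ⊢γ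

⊤' : Form
⊤' = ~ (var 0 ∧' ~ var 0)

⊨-⊤ : f ⊨ ⊤'
⊨-⊤ = ⊨-~⁺ λ c → ⊨-~ (proj₂ (⊨-∧ c)) (proj₁ (⊨-∧ c))

conj : List Form → Form
conj []      = ⊤'
conj (γ ∷ Γ) = γ ∧' conj Γ

⊨-conj : ∀ Γ → f ⊨ conj Γ → All (f ⊨_) Γ
⊨-conj []      _ = []
⊨-conj (γ ∷ Γ) h = proj₁ (⊨-∧ h) ∷ ⊨-conj Γ (proj₂ (⊨-∧ h))

⊨-conj⁺ : All (f ⊨_) Γ → f ⊨ conj Γ
⊨-conj⁺ []       = ⊨-⊤
⊨-conj⁺ (h ∷ hs) = ⊨-∧⁺ h (⊨-conj⁺ hs)

record BelowK (□ : Form → Form) : Set where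
  field
    distrib : ∀ {φ ψ} → ⊢ (□ (φ ⇒ ψ) ⇒ (□ φ ⇒ □ ψ))
    from-K  : ∀ {φ} → ⊢ (K φ ⇒ □ φ)

K-below : BelowK K
K-below = record { distrib = K-K ; from-K = consequence [] λ f _ → ⊨-⇒⁺ id }

E-below : BelowK E
E-below = record { distrib = E-K ; from-K = KE }

B-below : BelowK B
B-below = record { distrib = B-K ; from-K = KB }

module BelowKProperties {□ : Form → Form} (below : BelowK □) where
  open BelowK below

  necessitation : ⊢ φ → ⊢ □ φ
  necessitation ⊢φ = mp from-K (K-nec ⊢φ)

  monotone : ⊢ (φ ⇒ ψ) → ⊢ (□ φ ⇒ □ ψ)
  monotone ⊢φ⇒ψ = mp distrib (necessitation ⊢φ⇒ψ)

  □-∧ : ⊢ (□ φ ⇒ (□ ψ ⇒ □ (φ ∧' ψ)))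
  □-∧ {φ} {ψ} =
    consequence (monotone pairing ∷ distrib ∷ []) λ where
      f (pair ∷ dist ∷ []) → ⊨-⇒⁺ λ □φ → ⊨-⇒ dist (⊨-⇒ pair □φ)
    where
    pairing : ⊢ (φ ⇒ (ψ ⇒ (φ ∧' ψ)))
    pairing = consequence [] λ f _ → ⊨-⇒⁺ λ p → ⊨-⇒⁺ λ q → ⊨-∧⁺ p q

  □-conj : ∀ Γ → ⊢ (conj (map □ Γ) ⇒ □ (conj Γ))
  □-conj [] = consequence (necessitation (consequence [] λ f _ → ⊨-⊤) ∷ []) λ where
    f (□⊤ ∷ []) → ⊨-⇒⁺ λ _ → □⊤
  □-conj (γ ∷ Γ) = consequence (□-conj Γ ∷ □-∧ ∷ []) λ where
    f (ih ∷ pair ∷ []) → ⊨-⇒⁺ λ h →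
      ⊨-⇒ (⊨-⇒ pair (proj₁ (⊨-∧ h))) (⊨-⇒ ih (proj₂ (⊨-∧ h)))

  transfer : ⊢ (θ ⇒ K θ) → ⊢ (θ ⇒ (conj Γ ⇒ ψ)) → ⊢ (θ ⇒ (conj (map □ Γ) ⇒ □ ψ))
  transfer {θ} {Γ} {ψ} introspective entails =
    consequence (introspective ∷ from-K ∷ □-conj (θ ∷ Γ) ∷ monotone uncurried ∷ []) λ where
      f (intro ∷ fromK ∷ conj□ ∷ mono ∷ []) → ⊨-⇒⁺ λ hθ → ⊨-⇒⁺ λ h□Γ →
        ⊨-⇒ mono (⊨-⇒ conj□ (⊨-∧⁺ (⊨-⇒ fromK (⊨-⇒ intro hθ)) h□Γ))
    where
    uncurried : ⊢ (conj (θ ∷ Γ) ⇒ ψ)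
    uncurried = consequence (entails ∷ []) λ where
      f (e ∷ []) → ⊨-⇒⁺ λ h → ⊨-⇒ (⊨-⇒ e (proj₁ (⊨-∧ h))) (proj₂ (⊨-∧ h))

open BelowKProperties using (transfer; □-conj)

belief-consistent : ⊢ (θ ⇒ K θ) → ⊢ (θ ⇒ ~ conj Γ) → ⊢ (θ ⇒ ~ conj (map B Γ))
belief-consistent {θ} {Γ} introspective refutes =
  consequence (transfer B-below {Γ = []} introspective vacuous ∷ □-conj B-below Γ ∷ B-D ∷ []) λ where
    f (t ∷ conj□ ∷ d ∷ []) → ⊨-⇒⁺ λ hθ → ⊨-~⁺ λ hBΓ →
      ⊨-~ (⊨-⇒ d (⊨-⇒ conj□ hBΓ)) (⊨-⇒ (⊨-⇒ t hθ) ⊨-⊤)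
  where
  vacuous : ⊢ (θ ⇒ (conj [] ⇒ ~ conj Γ))
  vacuous = consequence (refutes ∷ []) λ where
    f (r ∷ []) → ⊨-⇒⁺ λ hθ → ⊨-⇒⁺ λ _ → ⊨-⇒ r hθ

¬B-introspective : ⊢ (~ B φ ⇒ K (~ B φ))
¬B-introspective {φ} =
  consequence (K-T ∷ K-5 ∷ BelowKProperties.monotone K-below contra ∷ []) λ where
    f (kt ∷ k5 ∷ mono ∷ []) → ⊨-⇒⁺ λ ¬Bφ →
      ⊨-⇒ mono (⊨-⇒ k5 (⊨-~⁺ λ KBφ → ⊨-~ ¬Bφ (⊨-⇒ kt KBφ)))
  where
  contra : ⊢ (~ K (B φ) ⇒ ~ B φ)
  contra = consequence (BKB ∷ []) λ where
    f (bkb ∷ []) → ⊨-⇒⁺ λ ¬KBφ → ⊨-~⁺ λ Bφ → ⊨-~ ¬KBφ (⊨-⇒ bkb Bφ)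

conj-introspective : All (λ γ → ⊢ (γ ⇒ K γ)) Γ → ⊢ (conj Γ ⇒ K (conj Γ))
conj-introspective [] = consequence (K-nec (consequence [] λ f _ → ⊨-⊤) ∷ []) λ where
  f (k⊤ ∷ []) → ⊨-⇒⁺ λ _ → k⊤
conj-introspective (i ∷ is) =
  consequence (i ∷ conj-introspective is ∷ BelowKProperties.□-∧ K-below ∷ []) λ where
    f (hi ∷ his ∷ pair ∷ []) → ⊨-⇒⁺ λ h →
      ⊨-⇒ (⊨-⇒ pair (⊨-⇒ hi (proj₁ (⊨-∧ h)))) (⊨-⇒ his (proj₂ (⊨-∧ h)))

lit : Form → Bool → Form
lit a true  = a
lit a false = ~ a

⊨-lit : ∀ b → f ⊨ lit a b → evalPL f a ≡ b
⊨-lit true  h = ⊨-elim h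
⊨-lit false h = ¬-not (⊨-~ h ∘ ⊨-intro)

⊨-lit⁺ : ∀ b → evalPL f a ≡ b → f ⊨ lit a b
⊨-lit⁺ true  e = ⊨-intro e
⊨-lit⁺ false e = ⊨-~⁺ λ h → not-¬ (⊨-elim h) e

char : List Form → (Form → Bool) → Form
char L g = conj (map (λ a → lit a (g a)) L)

⊨-char : ∀ L → f ⊨ char L g → All (λ a → evalPL f a ≡ g a) L
⊨-char {g = g} L h = All.map (⊨-lit (g _)) (map⁻ (⊨-conj (map (λ a → lit a (g a)) L) h))

⊨-char⁺ : All (λ a → evalPL f a ≡ g a) L → f ⊨ char L g
⊨-char⁺ {g = g} hs = ⊨-conj⁺ (map⁺ (All.map (⊨-lit⁺ (g _)) hs))

-- Knowledge and belief facts, positive or negative, are known when true.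
data Introspective : Form → Set where
  K-introspective : Introspective (K φ)
  B-introspective : Introspective (B φ)

introspective? : ∀ a → Dec (Introspective a)
introspective? (var _)  = no λ ()
introspective? (~ _)    = no λ ()
introspective? (_ ∧' _) = no λ ()
introspective? (E _)    = no λ ()
introspective? (K _)    = yes K-introspective
introspective? (B _)    = yes B-introspective

lit-introspective : Introspective a → ∀ b → ⊢ (lit a b ⇒ K (lit a b))
lit-introspective K-introspective true  = K-4
lit-introspective K-introspective false = K-5
lit-introspective B-introspective true  = BKB
lit-introspective B-introspective false = ¬B-introspective

char-introspective : All Introspective L → ⊢ (char L g ⇒ K (char L g))
char-introspective {g = g} is =
  conj-introspective (map⁺ (All.map (λ i → lit-introspective i (g _)) is))

_≟_ : DecidableEquality Form
var p    ≟ var q      = map′ (cong var) (λ { refl → refl }) (p ≟ℕ q)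
(~ φ)    ≟ (~ ψ)      = map′ (cong ~_) (λ { refl → refl }) (φ ≟ ψ)
(φ ∧' ψ) ≟ (φ' ∧' ψ') =
  map′ (λ { (refl , refl) → refl }) (λ { refl → refl , refl }) ((φ ≟ φ') ×-dec (ψ ≟ ψ'))
E φ      ≟ E ψ        = map′ (cong E) (λ { refl → refl }) (φ ≟ ψ)
K φ      ≟ K ψ        = map′ (cong K) (λ { refl → refl }) (φ ≟ ψ)
B φ      ≟ B ψ        = map′ (cong B) (λ { refl → refl }) (φ ≟ ψ)
var _    ≟ ~ _        = no λ ()
var _    ≟ (_ ∧' _)   = no λ ()
var _    ≟ E _        = no λ ()
var _    ≟ K _        = no λ ()
var _    ≟ B _        = no λ ()
(~ _)    ≟ var _      = no λ ()
(~ _)    ≟ (_ ∧' _)   = no λ ()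
(~ _)    ≟ E _        = no λ ()
(~ _)    ≟ K _        = no λ ()
(~ _)    ≟ B _        = no λ ()
(_ ∧' _) ≟ var _      = no λ ()
(_ ∧' _) ≟ ~ _        = no λ ()
(_ ∧' _) ≟ E _        = no λ ()
(_ ∧' _) ≟ K _        = no λ ()
(_ ∧' _) ≟ B _        = no λ ()
E _      ≟ var _      = no λ ()
E _      ≟ ~ _        = no λ ()
E _      ≟ (_ ∧' _)   = no λ ()
E _      ≟ K _        = no λ ()
E _      ≟ B _        = no λ ()
K _      ≟ var _      = no λ ()
K _      ≟ ~ _        = no λ ()
K _      ≟ (_ ∧' _)   = no λ ()
K _      ≟ E _        = no λ ()
K _      ≟ B _        = no λ ()
B _      ≟ var _      = no λ ()
B _      ≟ ~ _        = no λ ()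
B _      ≟ (_ ∧' _)   = no λ ()
B _      ≟ E _        = no λ ()
B _      ≟ K _        = no λ ()

open import Data.List.Membership.DecPropositional _≟_ using (_∈?_)

atoms : Form → List Form
atoms (var p)  = var p ∷ []
atoms (~ φ)    = atoms φ
atoms (φ ∧' ψ) = atoms φ ++ atoms ψ
atoms (E φ)    = E φ ∷ atoms φ
atoms (K φ)    = K φ ∷ atoms φ
atoms (B φ)    = B φ ∷ atoms φ

eval-atom : ∀ φ → a ∈ atoms φ → evalPL f a ≡ f a
eval-atom (var _)  (here refl) = refl
eval-atom (~ φ)    a∈          = eval-atom φ a∈
eval-atom (φ ∧' ψ) a∈          = Sum.[ eval-atom φ , eval-atom ψ ] (∈-++⁻ (atoms φ) a∈)
eval-atom (E _)    (here refl) = refl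
eval-atom (E φ)    (there a∈)  = eval-atom φ a∈
eval-atom (K _)    (here refl) = refl
eval-atom (K φ)    (there a∈)  = eval-atom φ a∈
eval-atom (B _)    (here refl) = refl
eval-atom (B φ)    (there a∈)  = eval-atom φ a∈

eval-cong : ∀ φ → (∀ {a} → a ∈ atoms φ → f a ≡ g a) → evalPL f φ ≡ evalPL g φ
eval-cong (var _)  agree = agree (here refl)
eval-cong (~ φ)    agree = cong not (eval-cong φ agree)
eval-cong (φ ∧' ψ) agree =
  cong₂ _∧_ (eval-cong φ (agree ∘ ∈-++⁺ˡ)) (eval-cong ψ (agree ∘ ∈-++⁺ʳ (atoms φ)))
eval-cong (E _)    agree = agree (here refl)
eval-cong (K _)    agree = agree (here refl)
eval-cong (B _)    agree = agree (here refl)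

atoms-closed : ∀ φ → a ∈ atoms φ → atoms a ⊆ atoms φ
atoms-closed (var _)  (here refl) = id
atoms-closed (~ φ)    a∈          = atoms-closed φ a∈
atoms-closed (φ ∧' ψ) a∈          with ∈-++⁻ (atoms φ) a∈
... | inj₁ a∈φ = ∈-++⁺ˡ ∘ atoms-closed φ a∈φ
... | inj₂ a∈ψ = ∈-++⁺ʳ (atoms φ) ∘ atoms-closed ψ a∈ψ
atoms-closed (E _)    (here refl) = id
atoms-closed (E φ)    (there a∈)  = there ∘ atoms-closed φ a∈
atoms-closed (K _)    (here refl) = id
atoms-closed (K φ)    (there a∈)  = there ∘ atoms-closed φ a∈
atoms-closed (B _)    (here refl) = id
atoms-closed (B φ)    (there a∈)  = there ∘ atoms-closed φ a∈

body : Form → List Form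
body (E φ) = φ ∷ []
body (K φ) = φ ∷ []
body (B φ) = φ ∷ []
body _     = []

body-atoms : ψ ∈ body a → atoms ψ ⊆ atoms a
body-atoms {a = E _} (here refl) = there
body-atoms {a = K _} (here refl) = there
body-atoms {a = B _} (here refl) = there

valuation : List Form → List Bool → Form → Bool
valuation (a ∷ as) (b ∷ bs) c = if does (a ≟ c) then b else valuation as bs c
valuation _        _        _ = false

valuation-map : ∀ f {as c} → c ∈ as → valuation as (map f as) c ≡ f c
valuation-map f {a ∷ as} {c} c∈ with a ≟ c | c∈
... | yes a≡c | _          = cong f a≡c
... | no  a≢c | here c≡a   = ⊥-elim (a≢c (sym c≡a))
... | no  _   | there c∈as = valuation-map f c∈as

boolLists : ℕ → List (List Bool)
boolLists zero    = [] ∷ []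
boolLists (suc n) = map (true ∷_) (boolLists n) ++ map (false ∷_) (boolLists n)

boolLists-complete : ∀ bs → bs ∈ boolLists (length bs)
boolLists-complete []           = here refl
boolLists-complete (true ∷ bs)  = ∈-++⁺ˡ (∈-map⁺ (true ∷_) (boolLists-complete bs))
boolLists-complete (false ∷ bs) =
  ∈-++⁺ʳ (map (true ∷_) (boolLists (length bs))) (∈-map⁺ (false ∷_) (boolLists-complete bs))

search : ∀ {A : Set} {P Q : A → Set} → (∀ x → P x ⊎ Q x) →
         ∀ xs → All P xs ⊎ ∃ λ x → x ∈ xs × Q x
search classify []       = inj₁ []
search classify (x ∷ xs) with classify x | search classify xs
... | inj₂ q | _                   = inj₂ (x , here refl , q)
... | inj₁ p | inj₁ ps             = inj₁ (p ∷ ps)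
... | inj₁ _ | inj₂ (y , y∈xs , q) = inj₂ (y , there y∈xs , q)

refute-⇒ : ∀ {X Y : Set} → Dec X → ¬ (X → Y) → X × ¬ Y
refute-⇒ (yes x) h = x , λ y → h λ _ → y
refute-⇒ (no ¬x) h = ⊥-elim (h λ x → ⊥-elim (¬x x))

module Completeness (φ : Form) where

  A : List Form
  A = atoms φ

  -- A type: a truth assignment to the atoms of φ, listed in order.
  Type : Set
  Type = List Bool

  variable
    t u x y : Type
    S : List Type
    □ : Form → Form

  val : Type → Form → Bool
  val = valuation A

  typeOf : (Form → Bool) → Type
  typeOf f = map f A

  types : List Type
  types = boolLists (length A)

  typeOf∈types : ∀ f → typeOf f ∈ types
  typeOf∈types f =
    subst (λ n → typeOf f ∈ boolLists n) (length-map f A) (boolLists-complete (typeOf f))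

  Agree : (Form → Bool) → Type → Set
  Agree f t = ∀ {a} → a ∈ A → f a ≡ val t a

  agree-typeOf : ∀ f → Agree f (typeOf f)
  agree-typeOf f a∈ = sym (valuation-map f a∈)

  agree-atom : Agree f t → a ∈ A → f ⊨ a ⇔ val t a ≡ true
  agree-atom ag a∈ = mk⇔ (λ h → trans (sym e) (⊨-elim h)) (λ v → ⊨-intro (trans e v))
    where e = trans (eval-atom φ a∈) (ag a∈)

  agree-⊨ : Agree f t → atoms ψ ⊆ A → f ⊨ ψ ⇔ val t ⊨ ψ
  agree-⊨ {ψ = ψ} ag sub = mk⇔ (λ h → ⊨-intro (trans (sym e) (⊨-elim h)))
                                (λ h → ⊨-intro (trans e (⊨-elim h)))
    where e = eval-cong ψ (ag ∘ sub)

  -- The K- and B-atoms of φ; a type's values on them form its profile.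
  KBA : List Form
  KBA = filter introspective? A

  KBA⊆A : KBA ⊆ A
  KBA⊆A = proj₁ ∘ ∈-filter⁻ introspective? {xs = A}

  χ π : Type → Form
  χ t = char A (val t)
  π t = char KBA (val t)

  ⊨χ⇒agree : f ⊨ χ t → Agree f t
  ⊨χ⇒agree h a∈ = trans (sym (eval-atom φ a∈)) (All.lookup (⊨-char A h) a∈)

  agree⇒⊨χ : Agree f t → f ⊨ χ t
  agree⇒⊨χ ag = ⊨-char⁺ (All.tabulate λ a∈ → trans (eval-atom φ a∈) (ag a∈))

  agree⇒⊨π : Agree f t → f ⊨ π t
  agree⇒⊨π ag = ⊨-char⁺ (All.tabulate λ a∈ → trans (eval-atom φ (KBA⊆A a∈)) (ag (KBA⊆A a∈)))

  -- Profiles consist of K- and B-literals, hence are known whenever true.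
  π-introspective : ⊢ (π t ⇒ K (π t))
  π-introspective = char-introspective (All.tabulate (proj₂ ∘ ∈-filter⁻ introspective? {xs = A}))

  Same : Type → Type → Set
  Same t u = All (λ a → val t a ≡ val u a) KBA

  same? : ∀ t u → Dec (Same t u)
  same? t u = all? (λ a → val t a ≟ᵇ val u a) KBA

  same-trans : Same t u → Same u x → Same t x
  same-trans p q = All.zipWith (λ (e₁ , e₂) → trans e₁ e₂) (p , q)

  ⊨π⇒same : f ⊨ π t → Same t (typeOf f)
  ⊨π⇒same {f} h = All.tabulate λ a∈ →
    trans (sym (All.lookup (⊨-char KBA h) a∈))
          (trans (eval-atom φ (KBA⊆A a∈)) (agree-typeOf f (KBA⊆A a∈)))

  Sub : List Form
  Sub = concatMap body A

  Sub-atoms : ψ ∈ Sub → atoms ψ ⊆ A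
  Sub-atoms ψ∈ with find (∈-concatMap⁻ body {xs = A} ψ∈)
  ... | a , a∈A , ψ∈body = atoms-closed φ a∈A ∘ body-atoms ψ∈body

  bodies : (Form → Form) → List Form
  bodies □ = filter (λ ψ → □ ψ ∈? A) Sub

  -- For □ among E, K, B the premise ψ ∈ body (□ ψ) holds by definition.
  ∈-bodies : ψ ∈ body (□ ψ) → □ ψ ∈ A → ψ ∈ bodies □
  ∈-bodies {ψ} {□} ψ∈ □ψ∈A = ∈-filter⁺ (λ ψ → □ ψ ∈? A) (∈-concatMap⁺ body (lose □ψ∈A ψ∈)) □ψ∈A

  bodies-Sub : ψ ∈ bodies □ → ψ ∈ Sub
  bodies-Sub {□ = □} = proj₁ ∘ ∈-filter⁻ (λ ψ → □ ψ ∈? A) {xs = Sub}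

  bodies-A : ψ ∈ bodies □ → □ ψ ∈ A
  bodies-A {□ = □} = proj₂ ∘ ∈-filter⁻ (λ ψ → □ ψ ∈? A) {xs = Sub}

  accepted : (Form → Form) → Type → List Form
  accepted □ t = filter (λ ψ → val t (□ ψ) ≟ᵇ true) (bodies □)

  ∈-accepted⁻ : ψ ∈ accepted □ t → ψ ∈ bodies □ × val t (□ ψ) ≡ true
  ∈-accepted⁻ {□ = □} {t} = ∈-filter⁻ (λ ψ → val t (□ ψ) ≟ᵇ true)

  Succ : (Form → Form) → Type → Type → Set
  Succ □ t u = All (val u ⊨_) (accepted □ t)

  succ? : ∀ □ t u → Dec (Succ □ t u)
  succ? □ t u = all? (⊨? (val u)) (accepted □ t)

  succ-⊨ : Succ □ t u → ψ ∈ bodies □ → val t (□ ψ) ≡ true → val u ⊨ ψ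
  succ-⊨ {□} {t} succ ψ∈ v = All.lookup succ (∈-filter⁺ (λ ψ → val t (□ ψ) ≟ᵇ true) ψ∈ v)

  ⊨accepted⇒succ : f ⊨ conj (accepted □ t) → Succ □ t (typeOf f)
  ⊨accepted⇒succ {f} {□} {t} h = All.tabulate λ ψ∈ →
    to (agree-⊨ (agree-typeOf f) (Sub-atoms (bodies-Sub (proj₁ (∈-accepted⁻ ψ∈)))))
       (All.lookup (⊨-conj (accepted □ t) h) ψ∈)

  agree⇒⊨□accepted : Agree f t → f ⊨ conj (map □ (accepted □ t))
  agree⇒⊨□accepted ag = ⊨-conj⁺ (map⁺ (All.tabulate λ ψ∈ →
    let ψ∈bodies , v = ∈-accepted⁻ ψ∈ in from (agree-atom ag (bodies-A ψ∈bodies)) v))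

  Cover : List Type → Set
  Cover S = ∀ ψ → (∀ f → typeOf f ∈ S → f ⊨ ψ) → ⊢ ψ

  cover-types : Cover types
  cover-types ψ h = consequence [] λ f _ → h f (typeOf∈types f)

  remove : Type → List Type → List Type
  remove t = filter (λ u → ¬? (≡-decᴸ _≟ᵇ_ u t))

  remove-shorter : t ∈ S → length (remove t S) < length S
  remove-shorter {t} {S} t∈S =
    filter-notAll (λ u → ¬? (≡-decᴸ _≟ᵇ_ u t)) S (Any.map (λ t≡u u≢t → u≢t (sym t≡u)) t∈S)

  cover-remove : Cover S → ⊢ ~ χ t → Cover (remove t S)
  cover-remove {S} {t} cover ⊢¬χ ψ h = mp (cover (~ χ t ⇒ ψ) λ f u∈S → ⊨-⇒⁺ λ ¬χ →
      h f (∈-filter⁺ (λ u → ¬? (≡-decᴸ _≟ᵇ_ u t)) u∈S λ u≡t →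
        ⊨-~ ¬χ (agree⇒⊨χ (subst (Agree f) u≡t (agree-typeOf f))))) ⊢¬χ

  refute : ⊢ θ → (∀ f → Agree f t → ¬ f ⊨ θ) → ⊢ ~ χ t
  refute ⊢θ falsifies = consequence (⊢θ ∷ []) λ where
    f (hθ ∷ []) → ⊨-~⁺ λ hχ → falsifies f (⊨χ⇒agree hχ) hθ

  Refutes : (Form → Form) → Type → Form → Type → Set
  Refutes □ t ψ u = Same t u × Succ □ t u × ¬ val u ⊨ ψ

  Serial : Type → Type → Set
  Serial t u = Same t u × Succ B t u

  entails : Cover S → ψ ∈ Sub → ¬ Any (Refutes □ t ψ) S →
            ⊢ (π t ⇒ (conj (accepted □ t) ⇒ ψ))
  entails {ψ = ψ} cover ψ∈ none = cover _ λ f u∈S → ⊨-⇒⁺ λ hπ → ⊨-⇒⁺ λ hacc →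
    from (agree-⊨ (agree-typeOf f) (Sub-atoms ψ∈)) (decidable-stable (⊨? _ ψ) λ ¬ψ →
      none (lose u∈S (⊨π⇒same hπ , ⊨accepted⇒succ hacc , ¬ψ)))

  entails-serial : Cover S → ¬ Any (Serial t) S → ⊢ (π t ⇒ ~ conj (accepted B t))
  entails-serial cover none = cover _ λ f u∈S → ⊨-⇒⁺ λ hπ → ⊨-~⁺ λ hacc →
    none (lose u∈S (⊨π⇒same hπ , ⊨accepted⇒succ hacc))

  -- The ways in which a type t can fail to be realisable inside S; each
  -- carries the axiom that refutes t.
  data Defect (S : List Type) (t : Type) : Set where
    unreflexive : (⊢ (□ ψ ⇒ ψ)) → ψ ∈ bodies □ → val t (□ ψ) ≡ true → ¬ val t ⊨ ψ → Defect S t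
    unwitnessed : BelowK □ → ψ ∈ bodies □ → val t (□ ψ) ≡ false → ¬ Any (Refutes □ t ψ) S →
                  Defect S t
    unserial    : ¬ Any (Serial t) S → Defect S t

  -- Every defect refutes its type: by factivity, by transfer along a normal
  -- operator below K, or by consistency of belief.
  eliminate : Cover S → Defect S t → ⊢ ~ χ t
  eliminate _ (unreflexive factive ψ∈ v ¬ψ) = refute factive λ f ag h →
    ¬ψ (to (agree-⊨ ag (Sub-atoms (bodies-Sub ψ∈))) (⊨-⇒ h (from (agree-atom ag (bodies-A ψ∈)) v)))
  eliminate cover (unwitnessed below ψ∈ v none) =
    refute (transfer below π-introspective (entails cover (bodies-Sub ψ∈) none)) λ f ag h →
      not-¬ (to (agree-atom ag (bodies-A ψ∈)) (⊨-⇒ (⊨-⇒ h (agree⇒⊨π ag)) (agree⇒⊨□accepted ag))) v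
  eliminate cover (unserial none) =
    refute (belief-consistent π-introspective (entails-serial cover none)) λ f ag h →
      ⊨-~ (⊨-⇒ h (agree⇒⊨π ag)) (agree⇒⊨□accepted ag)

  Reflects : (Form → Form) → Type → Form → Set
  Reflects □ t ψ = val t (□ ψ) ≡ true → val t ⊨ ψ

  Witnessed : List Type → (Form → Form) → Type → Form → Set
  Witnessed S □ t ψ = val t (□ ψ) ≡ false → Any (Refutes □ t ψ) S

  record Coherent (S : List Type) (t : Type) : Set where
    constructor coherent
    field
      K-reflects  : All (Reflects K t) (bodies K)
      E-reflects  : All (Reflects E t) (bodies E)
      K-witnessed : All (Witnessed S K t) (bodies K)
      E-witnessed : All (Witnessed S E t) (bodies E)
      B-witnessed : All (Witnessed S B t) (bodies B)
      B-serial    : Any (Serial t) S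

  check-reflects : (∀ {ψ} → ⊢ (□ ψ ⇒ ψ)) → ∀ S t → All (Reflects □ t) (bodies □) ⊎ Defect S t
  check-reflects {□} factive S t = Sum.map₂ defect (search reflects? (bodies □))
    where
    reflects? : ∀ ψ → Reflects □ t ψ ⊎ ¬ Reflects □ t ψ
    reflects? ψ = toSum ((val t (□ ψ) ≟ᵇ true) →-dec ⊨? (val t) ψ)
    defect : (∃ λ ψ → ψ ∈ bodies □ × ¬ Reflects □ t ψ) → Defect S t
    defect (ψ , ψ∈ , fails) = let v , ¬ψ = refute-⇒ (val t (□ ψ) ≟ᵇ true) fails
                              in unreflexive factive ψ∈ v ¬ψ

  check-witnessed : BelowK □ → ∀ S t → All (Witnessed S □ t) (bodies □) ⊎ Defect S t
  check-witnessed {□} below S t = Sum.map₂ defect (search witnessed? (bodies □))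
    where
    refutes? : ∀ ψ u → Dec (Refutes □ t ψ u)
    refutes? ψ u = same? t u ×-dec succ? □ t u ×-dec ¬? (⊨? (val u) ψ)
    witnessed? : ∀ ψ → Witnessed S □ t ψ ⊎ ¬ Witnessed S □ t ψ
    witnessed? ψ = toSum ((val t (□ ψ) ≟ᵇ false) →-dec any? (refutes? ψ) S)
    defect : (∃ λ ψ → ψ ∈ bodies □ × ¬ Witnessed S □ t ψ) → Defect S t
    defect (ψ , ψ∈ , fails) = let v , none = refute-⇒ (val t (□ ψ) ≟ᵇ false) fails
                              in unwitnessed below ψ∈ v none

  check-serial : ∀ S t → Any (Serial t) S ⊎ Defect S t
  check-serial S t = Sum.map₂ unserial (toSum (any? (λ u → same? t u ×-dec succ? B t u) S))

  _⊕_ : ∀ {P Q D : Set} → P ⊎ D → Q ⊎ D → (P × Q) ⊎ D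
  inj₁ p ⊕ inj₁ q = inj₁ (p , q)
  inj₁ _ ⊕ inj₂ d = inj₂ d
  inj₂ d ⊕ _      = inj₂ d
  infixr 4 _⊕_

  coherent? : ∀ S t → Coherent S t ⊎ Defect S t
  coherent? S t =
    Sum.map₁ (λ (r₁ , r₂ , w₁ , w₂ , w₃ , s) → coherent r₁ r₂ w₁ w₂ w₃ s)
      (check-reflects K-T S t ⊕ check-reflects E-T S t ⊕ check-witnessed K-below S t
       ⊕ check-witnessed E-below S t ⊕ check-witnessed B-below S t ⊕ check-serial S t)

  Stable : List Type → Set
  Stable S = All (Coherent S) S

  stabilise : ∀ S → Acc _<_ (length S) → Cover S → ∃ λ S′ → Cover S′ × Stable S′
  stabilise S (acc shorter) cover with search (coherent? S) S
  ... | inj₁ stable = S , cover , stable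
  ... | inj₂ (t , t∈S , defect) = stabilise (remove t S) (shorter (remove-shorter t∈S))
                                    (cover-remove cover (eliminate cover defect))

  stable-cover : ∃ λ S → Cover S × Stable S
  stable-cover = stabilise types (<-wellFounded _) cover-types

  module Countermodel {S : List Type} (stable : Stable S) {t₀ : Type} (t₀∈S : t₀ ∈ S) where

    -- Worlds are the types of S in the profile of t₀.
    Alive : Type → Set
    Alive x = x ∈ S × Same t₀ x

    coherent-at : Alive x → Coherent S x
    coherent-at (x∈S , _) = All.lookup stable x∈S

    same-profile : Alive x → Alive y → a ∈ KBA → val x a ≡ val y a
    same-profile (_ , same₀x) (_ , same₀y) a∈ =
      trans (sym (All.lookup same₀x a∈)) (All.lookup same₀y a∈)

    reflects⇒succ : All (Reflects □ x) (bodies □) → Succ □ x x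
    reflects⇒succ rs = All.tabulate λ ψ∈ →
      let ψ∈bodies , v = ∈-accepted⁻ ψ∈ in All.lookup rs ψ∈bodies v

    witness : Alive x → All (Witnessed S □ x) (bodies □) → ψ ∈ bodies □ → val x (□ ψ) ≡ false →
              ∃ λ u → Alive u × Succ □ x u × ¬ val u ⊨ ψ
    witness (_ , same₀x) ws ψ∈ v with find (All.lookup ws ψ∈ v)
    ... | u , u∈S , same , succ , ¬ψ = u , (u∈S , same-trans same₀x same) , succ , ¬ψ

    -- One piece of evidence, whose accessibility is E-succession among
    -- alive types; (E1) holds because alive types reflect E.
    model : EvidenceModel
    model = record
      { X = Type ; Ev = ⊤ ; x₀ = t₀ ; e₀ = tt
      ; I = λ _ x y → Alive x × Alive y × Succ E x y
      ; v = λ p x → val x (var p) ≡ true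
      }

    alive⇒U : Alive y → EvidenceModel.U model tt y
    alive⇒U ay = ay , ay , reflects⇒succ (Coherent.E-reflects (coherent-at ay))

    e1 : E1 model
    e1 _ _ _ (_ , ay , _) = alive⇒U ay

    V : Type → Set
    V y = Alive y × Succ B t₀ y

    alive₀ : Alive t₀
    alive₀ = t₀∈S , All.tabulate λ _ → refl

    scenario : Scenario model
    scenario = record
      { e = tt ; x = t₀ ; x∈U = alive⇒U alive₀ ; V = V ; V⊆U = λ _ → alive⇒U ∘ proj₁
      ; V≠∅ = let u , u∈S , same , succ = find (Coherent.B-serial (coherent-at alive₀))
              in u , (u∈S , same) , succ
      }

    Sat : Type → Form → Set
    Sat = sat model tt V

    Truthful : Form → Set
    Truthful ψ = ∀ {y} → Alive y → Sat y ψ ⇔ val y ⊨ ψ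

    -- Knowledge ranges over all alive worlds: a rejected Kψ has a witness,
    -- an accepted one is shared by the profile and reflected by every world.
    truth-K : Truthful ψ → K ψ ∈ A → Alive x → Sat x (K ψ) ⇔ val x ⊨ K ψ
    truth-K ih K∈ ax = mk⇔
      (λ h → ⊨-intro (¬-not λ v →
         let u , au , _ , ¬ψ = witness ax (Coherent.K-witnessed (coherent-at ax)) ψ∈ v
         in ¬ψ (to (ih au) (h u (alive⇒U au)))))
      (λ h y (ay , _) → from (ih ay) (All.lookup (Coherent.K-reflects (coherent-at ay)) ψ∈
         (trans (sym (same-profile ax ay (∈-filter⁺ introspective? K∈ K-introspective))) (⊨-elim h))))
      where ψ∈ = ∈-bodies (here refl) K∈

    -- Evidence ranges over alive E-successors, which satisfy what x accepts.
    truth-E : Truthful ψ → E ψ ∈ A → Alive x → Sat x (E ψ) ⇔ val x ⊨ E ψ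
    truth-E ih E∈ ax = mk⇔
      (λ h → ⊨-intro (¬-not λ v →
         let u , au , succ , ¬ψ = witness ax (Coherent.E-witnessed (coherent-at ax)) ψ∈ v
         in ¬ψ (to (ih au) (proj₂ (h u (ax , au , succ))))))
      (λ h y (_ , ay , succ) → alive⇒U ay , from (ih ay) (succ-⊨ succ ψ∈ (⊨-elim h)))
      where ψ∈ = ∈-bodies (here refl) E∈

    -- Belief is evaluated at t₀'s belief-successors, whose profile every alive x shares.
    truth-B : Truthful ψ → B ψ ∈ A → Alive x → Sat x (B ψ) ⇔ val x ⊨ B ψ
    truth-B {ψ} {x} ih B∈ ax = mk⇔
      (λ h → ⊨-intro (trans (sym v₀) (¬-not λ v →
         let u , au , succ , ¬ψ = witness alive₀ (Coherent.B-witnessed (coherent-at alive₀)) ψ∈ v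
         in ¬ψ (to (ih au) (proj₂ (h u (au , succ)))))))
      (λ h y (ay , succ) → alive⇒U ay , from (ih ay) (succ-⊨ succ ψ∈ (trans v₀ (⊨-elim h))))
      where
      ψ∈ = ∈-bodies (here refl) B∈
      v₀ : val t₀ (B ψ) ≡ val x (B ψ)
      v₀ = same-profile alive₀ ax (∈-filter⁺ introspective? B∈ B-introspective)

    truth : ∀ ψ → atoms ψ ⊆ A → Alive x → Sat x ψ ⇔ val x ⊨ ψ
    truth (var _)  _   _  = mk⇔ ⊨-intro ⊨-elim
    truth (~ ψ)    sub ax = mk⇔ (λ h → ⊨-~⁺ (h ∘ from ih)) (λ h → ⊨-~ h ∘ to ih)
      where ih = truth ψ sub ax
    truth (ψ ∧' θ) sub ax = mk⇔ (λ (p , q) → ⊨-∧⁺ (to ihψ p) (to ihθ q))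
                                (λ h → from ihψ (proj₁ (⊨-∧ h)) , from ihθ (proj₂ (⊨-∧ h)))
      where
      ihψ = truth ψ (sub ∘ ∈-++⁺ˡ) ax
      ihθ = truth θ (sub ∘ ∈-++⁺ʳ (atoms ψ)) ax
    truth (E ψ)    sub ax = truth-E (truth ψ (sub ∘ there)) (sub (here refl)) ax
    truth (K ψ)    sub ax = truth-K (truth ψ (sub ∘ there)) (sub (here refl)) ax
    truth (B ψ)    sub ax = truth-B (truth ψ (sub ∘ there)) (sub (here refl)) ax

    valid⇒⊨ : Valid-E1 φ → val t₀ ⊨ φ
    valid⇒⊨ valid = to (truth φ id alive₀) (valid model e1 scenario)

corollary2 : (φ : Form) → Valid-E1 φ → ⊢ φ
corollary2 φ valid = conclude stable-cover
  where
  open Completeness φ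
  conclude : (∃ λ S → Cover S × Stable S) → ⊢ φ
  conclude (S , cover , stable) with search (λ t → toSum (⊨? (val t) φ)) S
  ... | inj₁ all⊨ = cover φ λ f t∈S → from (agree-⊨ (agree-typeOf f) id) (All.lookup all⊨ t∈S)
  ... | inj₂ (t₀ , t₀∈S , ¬φ) = ⊥-elim (¬φ (Countermodel.valid⇒⊨ stable t₀∈S valid))
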